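{- Let $\sigma=uxzv$ and $\sigma'=uzxv$ be two permutations in $S_n$ written as words on $X=\{x_1<\dots<x_n\}$, where $x<z$ are letters of $X$ and $u,v$ are words on $X$. (1) If $v$ contains no letter $y\in X$ with $x<y<z$, then $\varphi(\sigma)$ and $\varphi(\sigma')$ differ by a diagonal flip. (2) If $v$ contains a letter $y$ with $x<y<z$, then $\varphi(\sigma)=\varphi(\sigma')$.
   Context: $X$ is a set of positive integers $x_1<\dots<x_n$, $\widehat{X}=X\cup\{0,\infty\}$ with $0<x_1<\dots<x_n<\infty$, and $P$ is a convex $(n+2)$-gon with vertices labelled by $\widehat{X}$ in clockwise increasing order; a triangulation of $P$ consists of $n-1$ noncrossing diagonals cutting $P$ into $n$ triangles (faces). Permutations in $S_n$ are words using each letter of $X$ exactly once. For $\sigma=x_{i_1}\cdots x_{i_n}$, $\varphi(\sigma)$ is the triangulation whose diagonals are, for $k=1,\dots,n-1$, the segments joining the predecessor and successor of $x_{i_k}$ in $\widehat{X}\setminus\{x_{i_1},\dots,x_{i_{k-1}}\}$. A diagonal flip of a diagonal $d$ of a triangulation replaces $d$ by the other diagonal of the quadrilateral formed by the two faces adjacent to $d$; two triangulations differ by a diagonal flip if one is obtained from the other by one such operation. -}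

module Defs where

open import Data.Nat using (ℕ; zero; suc; _<_; _<ᵇ_; _⊔_; _⊓_)
open import Data.Bool using (if_then_else_)
open import Data.List using (List; []; _∷_; _++_; map)
open import Data.List.Relation.Unary.Any using (Any)
open import Data.List.Membership.Propositional using (_∈_)
open import Data.Product using (_×_; _,_; Σ; ∃)
open import Data.Sum using (_⊎_)
open import Relation.Binary.PropositionalEquality using (_≡_)
open import Relation.Nullary using (¬_)
open import Function.Bundles using (_⇔_)

-- Vertices of the polygon P: labels in X̂ = X ∪ {0, ∞}.
-- The label 0 is  fin 0  (X consists of positive integers), ∞ is  ∞ .
data Vert : Set where
  fin : ℕ → Vert
  ∞   : Vert

-- A segment (diagonal or side) between two vertices; unordered, so
-- compared via SameSeg.
Seg : Set
Seg = Vert × Vert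

SameSeg : Seg → Seg → Set
SameSeg (a , b) (c , d) = (a ≡ c × b ≡ d) ⊎ (a ≡ d × b ≡ c)

-- A triangulation is represented by its list of diagonals;
-- membership is up to orientation of the segment.
_∈ₛ_ : Seg → List Seg → Set
e ∈ₛ T = Any (SameSeg e) T

SameTri : List Seg → List Seg → Set
SameTri T T' = ∀ e → (e ∈ₛ T) ⇔ (e ∈ₛ T')

vertsOf : List ℕ → List Vert
vertsOf X = fin 0 ∷ map fin X ++ ∞ ∷ []

consecutive : List Vert → List Seg
consecutive [] = []
consecutive (a ∷ []) = []
consecutive (a ∷ b ∷ l) = (a , b) ∷ consecutive (b ∷ l)

sidesOf : List ℕ → List Seg
sidesOf X = (∞ , fin 0) ∷ consecutive (vertsOf X)

IsSide : List ℕ → List Seg → Vert → Vert → Set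
IsSide X T a b = ((a , b) ∈ₛ T) ⊎ ((a , b) ∈ₛ sidesOf X)

Face : List ℕ → List Seg → Vert → Vert → Vert → Set
Face X T a b c =
  (a ∈ vertsOf X) × (b ∈ vertsOf X) × (c ∈ vertsOf X) ×
  ¬ (a ≡ b) × ¬ (b ≡ c) × ¬ (a ≡ c) ×
  IsSide X T a b × IsSide X T b c × IsSide X T a c

DiffByFlip : List ℕ → List Seg → List Seg → Set
DiffByFlip X T T' =
  Σ Vert λ a → Σ Vert λ b → Σ Vert λ p → Σ Vert λ q →
    ((a , b) ∈ₛ T) × Face X T a b p × Face X T a b q × ¬ (p ≡ q) ×
    (∀ e → (e ∈ₛ T') ⇔ (((e ∈ₛ T) × ¬ SameSeg e (a , b)) ⊎ SameSeg e (p , q)))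

-- Predecessor of x in X̂ ∖ removed, given the list L of remaining letters of X:
-- the largest element of L below x, or 0.
predN : ℕ → List ℕ → ℕ
predN x [] = 0
predN x (y ∷ L) = if y <ᵇ x then y ⊔ predN x L else predN x L

predIn : ℕ → List ℕ → Vert
predIn x L = fin (predN x L)

minV : Vert → Vert → Vert
minV (fin a) (fin b) = fin (a ⊓ b)
minV (fin a) ∞ = fin a
minV ∞ b = b

succIn : ℕ → List ℕ → Vert
succIn x [] = ∞
succIn x (y ∷ L) = if x <ᵇ y then minV (fin y) (succIn x L) else succIn x L

-- φ(σ): the k-th diagonal joins predecessor and successor of the k-th letter
-- in X̂ ∖ {first k-1 letters} = {0,∞} ∪ {letters k..n}, for k = 1..n-1.
φ : List ℕ → List Seg
φ [] = []
φ (x ∷ []) = []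
φ (x ∷ y ∷ rest) = (predIn x (y ∷ rest) , succIn x (y ∷ rest)) ∷ φ (y ∷ rest)

-- Removing the letters of a word from left to right, the diagonal drawn for a letter joins its two
-- neighbours among the letters not yet removed, together with 0 and ∞.  So φ(u x z v) and φ(u z x v)
-- begin with the same diagonals for the letters of u, since these only see the remaining letters as a
-- set, and end with the same φ(v); only the diagonals drawn for x and z can differ.
-- If a letter y of v lies between x and z, then x and z are never neighbours: each is cut off
-- between its neighbours in v̂ in either order, and the two triangulations coincide.
-- Otherwise, with a and b the neighbours of x in v̂, the first word draws az where the second draws xb,
-- and all later diagonals agree.  The triangles axz and azb on both sides of az exist because two
-- consecutive vertices of (x z v)̂ are always joined, by a side of P or by the diagonal of a letter of u.

{-# OPTIONS --safe #-}
module Submission where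

open import Defs
open import Data.Nat using (ℕ; _<_)
open import Data.List using (List; _∷_; _++_)
open import Data.List.Relation.Unary.All using (All)
open import Data.List.Relation.Unary.Linked using (Linked)
open import Data.List.Membership.Propositional using (_∈_)
open import Data.List.Relation.Binary.Permutation.Propositional using (_↭_)
open import Data.Product using (_×_; ∃)
open import Relation.Nullary using (¬_)

open import Data.Bool using (true; false)
open import Data.Empty using (⊥; ⊥-elim)
open import Data.Nat using (_≤_; _<ᵇ_; _⊔_; z≤n; _<?_)
open import Data.Nat.Properties
open import Data.List using ([]; map)
open import Data.List.Membership.Propositional using (_∉_)
open import Data.List.Membership.Propositional.Properties using (∈-++⁺ˡ; ∈-++⁺ʳ; ∈-++⁻; ∈-map⁺; ∈-map⁻)
open import Data.List.Relation.Binary.Subset.Propositional using (_⊆_)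
import Data.List.Relation.Unary.All as All
open import Data.List.Relation.Unary.All.Properties using (All¬⇒¬Any)
import Data.List.Relation.Unary.AllPairs as AllPairs
open import Data.List.Relation.Unary.Unique.Propositional using (Unique)
open import Data.List.Relation.Unary.Any using (here; there)
import Data.List.Relation.Unary.Any as Any
import Data.List.Relation.Unary.Any.Properties as Any
open import Data.List.Relation.Unary.Linked using ([-]; _∷_)
open import Data.List.Relation.Unary.Linked.Properties using (Linked⇒All; Linked⇒AllPairs)
import Data.List.Relation.Binary.Permutation.Propositional as Perm
import Data.List.Relation.Binary.Permutation.Propositional.Properties as Perm
open import Data.Product using (_,_; proj₂)
import Data.Product as Product
open import Data.Sum using (_⊎_; inj₁; inj₂)
import Data.Sum as Sum
open import Function using (_∘_)
open import Function.Bundles using (_⇔_; mk⇔)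
open import Relation.Binary using (tri<; tri≈; tri>)
open import Relation.Binary.PropositionalEquality using (_≡_; _≢_; refl; sym; trans; cong; cong₂; subst; subst₂; setoid)
open import Relation.Nullary using (Dec; yes; no; contradiction)
open import Data.List.Relation.Binary.Permutation.Setoid.Properties (setoid ℕ) using (Unique-resp-↭)
open import Relation.Nullary.Decidable using (map′)
open import Relation.Nullary.Reflects using (ofʸ; ofⁿ)

-- Vertices of P

infix 4 _<V_ _≤V_

data _<V_ : Vert → Vert → Set where
  fin<fin : ∀ {m n} → m < n → fin m <V fin n
  fin<∞   : ∀ {m} → fin m <V ∞

data _≤V_ : Vert → Vert → Set where
  fin≤fin : ∀ {m n} → m ≤ n → fin m ≤V fin n
  ≤∞      : ∀ {p} → p ≤V ∞

<V-irrefl : ∀ {p} → ¬ p <V p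
<V-irrefl (fin<fin n<n) = <-irrefl refl n<n

<V⇒≢ : ∀ {p q} → p <V q → p ≢ q
<V⇒≢ p<q refl = <V-irrefl p<q

<V-trans : ∀ {p q r} → p <V q → q <V r → p <V r
<V-trans (fin<fin p<q) (fin<fin q<r) = fin<fin (<-trans p<q q<r)
<V-trans (fin<fin _)   fin<∞         = fin<∞

<V-asym : ∀ {p q} → p <V q → ¬ q <V p
<V-asym p<q q<p = <V-irrefl (<V-trans p<q q<p)

_<V?_ : ∀ p q → Dec (p <V q)
fin m <V? fin n = map′ fin<fin (λ { (fin<fin m<n) → m<n }) (m <? n)
fin m <V? ∞     = yes fin<∞
∞     <V? q     = no λ ()

≤V-refl : ∀ {p} → p ≤V p
≤V-refl {fin n} = fin≤fin ≤-refl
≤V-refl {∞}     = ≤∞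

≤V-trans : ∀ {p q r} → p ≤V q → q ≤V r → p ≤V r
≤V-trans (fin≤fin p≤q) (fin≤fin q≤r) = fin≤fin (≤-trans p≤q q≤r)
≤V-trans _             ≤∞            = ≤∞

≤V-antisym : ∀ {p q} → p ≤V q → q ≤V p → p ≡ q
≤V-antisym (fin≤fin p≤q) (fin≤fin q≤p) = cong fin (≤-antisym p≤q q≤p)
≤V-antisym ≤∞            ≤∞            = refl

≤V-<V-trans : ∀ {p q r} → p ≤V q → q <V r → p <V r
≤V-<V-trans (fin≤fin p≤q) (fin<fin q<r) = fin<fin (≤-<-trans p≤q q<r)
≤V-<V-trans (fin≤fin _)   fin<∞         = fin<∞

≤V⇒≯V : ∀ {p q} → p ≤V q → ¬ q <V p
≤V⇒≯V (fin≤fin p≤q) (fin<fin q<p) = ≤⇒≯ p≤q q<p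

≮V⇒≥V : ∀ {p q} → ¬ p <V q → q ≤V p
≮V⇒≥V {fin m} {fin n} p≮q = fin≤fin (≮⇒≥ (p≮q ∘ fin<fin))
≮V⇒≥V {fin m} {∞}     p≮q = contradiction fin<∞ p≮q
≮V⇒≥V {∞}             _   = ≤∞

≮V-origin : ∀ {p} → ¬ p <V fin 0
≮V-origin (fin<fin ())

∞-≮V : ∀ {q} → ¬ ∞ <V q
∞-≮V ()

data VertexOf (L : List ℕ) : Vert → Set where
  origin   : VertexOf L (fin 0)
  letter   : ∀ {y} → y ∈ L → VertexOf L (fin y)
  infinity : VertexOf L ∞

VertexOf-mono : ∀ {L L′ V} → L ⊆ L′ → VertexOf L V → VertexOf L′ V
VertexOf-mono _    origin     = origin
VertexOf-mono L⊆L′ (letter y) = letter (L⊆L′ y)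
VertexOf-mono _    infinity   = infinity

VertexOf-fin⁻ : ∀ {L n} → VertexOf L (fin n) → n ≡ 0 ⊎ n ∈ L
VertexOf-fin⁻ origin     = inj₁ refl
VertexOf-fin⁻ (letter y) = inj₂ y

VertexOf⇒∈ : ∀ {L V} → VertexOf L V → V ∈ vertsOf L
VertexOf⇒∈     origin     = here refl
VertexOf⇒∈     (letter y) = there (∈-++⁺ˡ (∈-map⁺ fin y))
VertexOf⇒∈ {L} infinity   = there (∈-++⁺ʳ (map fin L) (here refl))

∈⇒VertexOf : ∀ {L V} → V ∈ vertsOf L → VertexOf L V
∈⇒VertexOf     (here refl) = origin
∈⇒VertexOf {L} (there V∈)  with ∈-++⁻ (map fin L) V∈
... | inj₂ (here refl) = infinity
... | inj₁ V∈L with ∈-map⁻ fin V∈L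
...   | _ , y∈L , refl = letter y∈L

vertsOf-↭ : ∀ {L L′} → L ↭ L′ → vertsOf L ↭ vertsOf L′
vertsOf-↭ L↭L′ = Perm.prep (fin 0) (Perm.++⁺ʳ (∞ ∷ []) (Perm.map⁺ fin L↭L′))

vertsOf-∷ : ∀ w L → fin w ∷ vertsOf L ↭ vertsOf (w ∷ L)
vertsOf-∷ w L = Perm.swap (fin w) (fin 0) Perm.refl

-- Predecessor and successor

⊔-pres : ∀ (P : ℕ → Set) {m n} → P m → P n → P (m ⊔ n)
⊔-pres P {m} {n} pm pn with ⊔-sel m n
... | inj₁ m⊔n≡m rewrite m⊔n≡m = pm
... | inj₂ m⊔n≡n rewrite m⊔n≡n = pn

minV-pres : ∀ (P : Vert → Set) {y} V → P (fin y) → P V → P (minV (fin y) V)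
minV-pres P     ∞       py _  = py
minV-pres P {y} (fin s) py ps with ⊓-sel y s
... | inj₁ y⊓s≡y rewrite y⊓s≡y = py
... | inj₂ y⊓s≡s rewrite y⊓s≡s = ps

minV-≤ˡ : ∀ y V → minV (fin y) V ≤V fin y
minV-≤ˡ y ∞       = ≤V-refl
minV-≤ˡ y (fin s) = fin≤fin (m⊓n≤m y s)

minV-≤ʳ : ∀ y V → minV (fin y) V ≤V V
minV-≤ʳ y ∞       = ≤∞
minV-≤ʳ y (fin s) = fin≤fin (m⊓n≤n y s)

predN-cases : ∀ w L → predN w L ≡ 0 ⊎ (predN w L ∈ L × predN w L < w)
predN-cases w []      = inj₁ refl
predN-cases w (y ∷ L) with y <ᵇ w | <ᵇ-reflects-< y w
... | true  | ofʸ y<w = ⊔-pres (λ p → p ≡ 0 ⊎ (p ∈ y ∷ L × p < w))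
      (inj₂ (here refl , y<w)) (Sum.map₂ (Product.map₁ there) (predN-cases w L))
... | false | _       = Sum.map₂ (Product.map₁ there) (predN-cases w L)

predIn-vertex : ∀ w L → VertexOf L (predIn w L)
predIn-vertex w L with predN-cases w L
... | inj₁ p≡0       rewrite p≡0 = origin
... | inj₂ (p∈L , _) = letter p∈L

predN≤ : ∀ w L → predN w L ≤ w
predN≤ w L with predN-cases w L
... | inj₁ p≡0       rewrite p≡0 = z≤n
... | inj₂ (_ , p<w) = <⇒≤ p<w

predN< : ∀ {w} L → 0 < w → predN w L < w
predN< {w} L 0<w with predN-cases w L
... | inj₁ p≡0       rewrite p≡0 = 0<w
... | inj₂ (_ , p<w) = p<w

predN-maximal : ∀ {w L y} → y ∈ L → y < w → y ≤ predN w L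
predN-maximal {w} {t ∷ L} (here refl) y<w with t <ᵇ w | <ᵇ-reflects-< t w
... | true  | _       = m≤m⊔n t (predN w L)
... | false | ofⁿ t≮w = contradiction y<w t≮w
predN-maximal {w} {t ∷ L} (there y∈L) y<w with t <ᵇ w
... | true  = ≤-trans (predN-maximal y∈L y<w) (m≤n⊔m t (predN w L))
... | false = predN-maximal y∈L y<w

predN-unique : ∀ {w L p} → VertexOf L (fin p) → p < w → (∀ {y} → y ∈ L → y < w → y ≤ p) →
  predN w L ≡ p
predN-unique {w} {L} {p} p∈ p<w maximal = ≤-antisym predN≤p p≤predN
  where
  predN≤p : predN w L ≤ p
  predN≤p with predN-cases w L
  ... | inj₁ q≡0           rewrite q≡0 = z≤n
  ... | inj₂ (q∈L , q<w) = maximal q∈L q<w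
  p≤predN : p ≤ predN w L
  p≤predN with VertexOf-fin⁻ p∈
  ... | inj₁ p≡0 rewrite p≡0 = z≤n
  ... | inj₂ p∈L = predN-maximal p∈L p<w

predN-∷-≥ : ∀ {w y} L → w ≤ y → predN w (y ∷ L) ≡ predN w L
predN-∷-≥ {w} {y} L w≤y with y <ᵇ w | <ᵇ-reflects-< y w
... | false | _       = refl
... | true  | ofʸ y<w = contradiction y<w (≤⇒≯ w≤y)

predN-mono : ∀ {w L L′} → L ⊆ L′ → predN w L ≤ predN w L′
predN-mono {w} {L} L⊆L′ with predN-cases w L
... | inj₁ p≡0         rewrite p≡0 = z≤n
... | inj₂ (p∈L , p<w) = predN-maximal (L⊆L′ p∈L) p<w

succIn-vertex : ∀ w L → VertexOf L (succIn w L)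
succIn-vertex w []      = infinity
succIn-vertex w (y ∷ L) with w <ᵇ y
... | true  = minV-pres (VertexOf (y ∷ L)) (succIn w L) (letter (here refl)) (VertexOf-mono there (succIn-vertex w L))
... | false = VertexOf-mono there (succIn-vertex w L)

succIn-above : ∀ w L → fin w <V succIn w L
succIn-above w []      = fin<∞
succIn-above w (y ∷ L) with w <ᵇ y | <ᵇ-reflects-< w y
... | true  | ofʸ w<y = minV-pres (fin w <V_) (succIn w L) (fin<fin w<y) (succIn-above w L)
... | false | _       = succIn-above w L

succIn-minimal : ∀ {w L y} → y ∈ L → w < y → succIn w L ≤V fin y
succIn-minimal {w} {t ∷ L} (here refl) w<y with w <ᵇ t | <ᵇ-reflects-< w t
... | true  | _       = minV-≤ˡ t (succIn w L)
... | false | ofⁿ w≮t = contradiction w<y w≮t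
succIn-minimal {w} {t ∷ L} (there y∈L) w<y with w <ᵇ t
... | true  = ≤V-trans (minV-≤ʳ t (succIn w L)) (succIn-minimal y∈L w<y)
... | false = succIn-minimal y∈L w<y

≤V-vertices-above : ∀ {w L s t} → VertexOf L s → fin w <V s →
  (∀ {y} → y ∈ L → w < y → t ≤V fin y) → t ≤V s
≤V-vertices-above origin     (fin<fin ())
≤V-vertices-above (letter y) (fin<fin w<y) bound = bound y w<y
≤V-vertices-above infinity   _             _     = ≤∞

succIn-unique : ∀ {w L s} → VertexOf L s → fin w <V s → (∀ {y} → y ∈ L → w < y → s ≤V fin y) →
  succIn w L ≡ s
succIn-unique {w} {L} s∈ w<s minimal =
  ≤V-antisym (≤V-vertices-above s∈ w<s succIn-minimal)
             (≤V-vertices-above (succIn-vertex w L) (succIn-above w L) minimal)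

succIn-∷-≤ : ∀ {w y} L → y ≤ w → succIn w (y ∷ L) ≡ succIn w L
succIn-∷-≤ {w} {y} L y≤w with w <ᵇ y | <ᵇ-reflects-< w y
... | false | _       = refl
... | true  | ofʸ w<y = contradiction w<y (≤⇒≯ y≤w)

succIn-mono : ∀ {w L L′} → L ⊆ L′ → succIn w L′ ≤V succIn w L
succIn-mono {w} {L} L⊆L′ =
  ≤V-vertices-above (succIn-vertex w L) (succIn-above w L) (succIn-minimal ∘ L⊆L′)

diagonal : ℕ → List ℕ → Seg
diagonal w L = predIn w L , succIn w L

predIn<succIn : ∀ w L → predIn w L <V succIn w L
predIn<succIn w L = ≤V-<V-trans (fin≤fin (predN≤ w L)) (succIn-above w L)

diagonal-resp-↭ : ∀ {w L L′} → L ↭ L′ → diagonal w L ≡ diagonal w L′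
diagonal-resp-↭ L↭L′ = cong₂ _,_
  (cong fin (≤-antisym (predN-mono (Perm.∈-resp-↭ L↭L′)) (predN-mono (Perm.∈-resp-↭ (Perm.↭-sym L↭L′)))))
  (≤V-antisym (succIn-mono (Perm.∈-resp-↭ (Perm.↭-sym L↭L′))) (succIn-mono (Perm.∈-resp-↭ L↭L′)))

between-diagonal : ∀ {w L y} → y ∈ L → predIn w L <V fin y → fin y <V succIn w L → y ≡ w
between-diagonal {w} {L} {y} y∈L p<y y<s with <-cmp y w
... | tri< y<w _ _ = contradiction p<y (≤V⇒≯V (fin≤fin (predN-maximal y∈L y<w)))
... | tri≈ _ y≡w _ = y≡w
... | tri> _ _ w<y = contradiction y<s (≤V⇒≯V (succIn-minimal y∈L w<y))

-- Consecutive vertices and sides of P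

record Adjacent (vs : List Vert) (p q : Vert) : Set where
  constructor adjacent
  field
    left∈   : p ∈ vs
    right∈  : q ∈ vs
    ordered : p <V q
    gap     : ∀ {r} → r ∈ vs → p <V r → r <V q → ⊥

open Adjacent using (left∈; right∈; ordered)

Adjacent-resp-↭ : ∀ {vs ws p q} → vs ↭ ws → Adjacent vs p q → Adjacent ws p q
Adjacent-resp-↭ vs↭ws (adjacent p∈ q∈ p<q gap) =
  adjacent (Perm.∈-resp-↭ vs↭ws p∈) (Perm.∈-resp-↭ vs↭ws q∈) p<q
           (λ r∈ → gap (Perm.∈-resp-↭ (Perm.↭-sym vs↭ws) r∈))

Adjacent-∷ : ∀ {vs p q r} → Adjacent vs p q → (p <V r → r <V q → ⊥) → Adjacent (r ∷ vs) p q
Adjacent-∷ (adjacent p∈ q∈ p<q gap) outside =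
  adjacent (there p∈) (there q∈) p<q λ { (here refl) → outside ; (there r∈) → gap r∈ }

Adjacent-split : ∀ {vs p q r} → Adjacent vs p q → p <V r → r <V q →
  Adjacent (r ∷ vs) p r × Adjacent (r ∷ vs) r q
Adjacent-split (adjacent p∈ q∈ p<q gap) p<r r<q =
  adjacent (there p∈) (here refl) p<r
    (λ { (here refl) _ r<r → <V-irrefl r<r ; (there s∈) p<s s<r → gap s∈ p<s (<V-trans s<r r<q) }) ,
  adjacent (here refl) (there q∈) r<q
    (λ { (here refl) r<r _ → <V-irrefl r<r ; (there s∈) r<s s<q → gap s∈ (<V-trans p<r r<s) s<q })

Linked-head< : ∀ {s l q} → Linked _<V_ (s ∷ l) → q ∈ l → s <V q
Linked-head< (s<t ∷ sorted) q∈l = All.lookup (Linked⇒All <V-trans s<t sorted) q∈l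

adjacent⇒consecutive : ∀ {vs p q} → Linked _<V_ vs → Adjacent vs p q → (p , q) ∈ₛ consecutive vs
adjacent⇒consecutive [-] (adjacent (here refl) (here refl) p<p _) = contradiction p<p <V-irrefl
adjacent⇒consecutive (_ ∷ _) (adjacent (here refl) (here refl) p<p _) = contradiction p<p <V-irrefl
adjacent⇒consecutive (_ ∷ _) (adjacent (here refl) (there (here refl)) _ _) = here (inj₁ (refl , refl))
adjacent⇒consecutive (p<s ∷ sorted) (adjacent (here refl) (there (there q∈)) _ gap) =
  ⊥-elim (gap (there (here refl)) p<s (Linked-head< sorted q∈))
adjacent⇒consecutive sorted@(_ ∷ _) (adjacent (there p∈) (here refl) p<q _) =
  contradiction p<q (<V-asym (Linked-head< sorted p∈))
adjacent⇒consecutive (_ ∷ sorted) (adjacent (there p∈) (there q∈) p<q gap) =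
  there (adjacent⇒consecutive sorted (adjacent p∈ q∈ p<q (λ r∈ → gap (there r∈))))

vertices-sorted : ∀ {c X} → Linked _<_ (c ∷ X) → Linked _<V_ (fin c ∷ map fin X ++ ∞ ∷ [])
vertices-sorted {X = []}    [-]            = fin<∞ ∷ [-]
vertices-sorted {X = _ ∷ _} (c<y ∷ sorted) = fin<fin c<y ∷ vertices-sorted sorted

vertsOf-sorted : ∀ {X} → Linked _<_ X → All (0 <_) X → Linked _<V_ (vertsOf X)
vertsOf-sorted {[]}    _      _               = vertices-sorted [-]
vertsOf-sorted {_ ∷ _} sorted (0<y All.∷ _) = vertices-sorted (0<y ∷ sorted)

adjacent-diagonal : ∀ {L p q w} → Adjacent (vertsOf L) p q → p <V fin w → fin w <V q →
  diagonal w L ≡ (p , q)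
adjacent-diagonal {L} {fin p} {q} {w} (adjacent p∈ q∈ _ gap) (fin<fin p<w) w<q =
  cong₂ _,_ (cong fin (predN-unique (∈⇒VertexOf p∈) p<w below)) (succIn-unique (∈⇒VertexOf q∈) w<q above)
  where
  below : ∀ {y} → y ∈ L → y < w → y ≤ p
  below y∈L y<w = ≮⇒≥ λ p<y → gap (VertexOf⇒∈ (letter y∈L)) (fin<fin p<y) (<V-trans (fin<fin y<w) w<q)
  above : ∀ {y} → y ∈ L → w < y → q ≤V fin y
  above y∈L w<y = ≮V⇒≥V λ y<q → gap (VertexOf⇒∈ (letter y∈L)) (fin<fin (<-trans p<w w<y)) y<q

gap-adjacent : ∀ {w L} → w ∉ L → Adjacent (vertsOf L) (predIn w L) (succIn w L)
gap-adjacent {w} {L} w∉L =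
  adjacent (VertexOf⇒∈ (predIn-vertex w L)) (VertexOf⇒∈ (succIn-vertex w L)) (predIn<succIn w L) gap
  where
  gap : ∀ {r} → r ∈ vertsOf L → predIn w L <V r → r <V succIn w L → ⊥
  gap r∈ p<r r<s with ∈⇒VertexOf r∈
  ... | origin     = ≮V-origin p<r
  ... | letter y∈L = w∉L (subst (_∈ L) (between-diagonal y∈L p<r r<s) y∈L)
  ... | infinity   = ∞-≮V r<s

insert-adjacent : ∀ {w L} → w ∉ L → 0 < w →
  Adjacent (vertsOf (w ∷ L)) (predIn w L) (fin w) × Adjacent (vertsOf (w ∷ L)) (fin w) (succIn w L)
insert-adjacent {w} {L} w∉L 0<w =
  Product.map (Adjacent-resp-↭ (vertsOf-∷ w L)) (Adjacent-resp-↭ (vertsOf-∷ w L))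
    (Adjacent-split (gap-adjacent w∉L) (fin<fin (predN< L 0<w)) (succIn-above w L))

-- Segments

≡⇒SameSeg : ∀ {d e : Seg} → d ≡ e → SameSeg d e
≡⇒SameSeg {_ , _} refl = inj₁ (refl , refl)

SameSeg-sym : ∀ {d e : Seg} → SameSeg d e → SameSeg e d
SameSeg-sym {_ , _} {_ , _} (inj₁ (refl , refl)) = inj₁ (refl , refl)
SameSeg-sym {_ , _} {_ , _} (inj₂ (refl , refl)) = inj₂ (refl , refl)

SameSeg-trans : ∀ {d e f : Seg} → SameSeg d e → SameSeg e f → SameSeg d f
SameSeg-trans {_ , _} {_ , _} {_ , _} (inj₁ (refl , refl)) e~f                  = e~f
SameSeg-trans {_ , _} {_ , _} {_ , _} (inj₂ (refl , refl)) (inj₁ (refl , refl)) = inj₂ (refl , refl)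
SameSeg-trans {_ , _} {_ , _} {_ , _} (inj₂ (refl , refl)) (inj₂ (refl , refl)) = inj₁ (refl , refl)

∈ₛ-resp-SameSeg : ∀ {d e T} → SameSeg d e → d ∈ₛ T → e ∈ₛ T
∈ₛ-resp-SameSeg d~e = Any.map (SameSeg-trans (SameSeg-sym d~e))

∈ₛ-middle : ∀ Dl {d R} → d ∈ₛ (Dl ++ d ∷ R)
∈ₛ-middle Dl = Any.++⁺ʳ Dl (here (≡⇒SameSeg refl))

IsSide-sym : ∀ {X T a b} → IsSide X T a b → IsSide X T b a
IsSide-sym = Sum.map (∈ₛ-resp-SameSeg (inj₂ (refl , refl))) (∈ₛ-resp-SameSeg (inj₂ (refl , refl)))

↭⇒SameTri : ∀ {T T′} → T ↭ T′ → SameTri T T′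
↭⇒SameTri T↭T′ _ = mk⇔ (Perm.Any-resp-↭ T↭T′) (Perm.Any-resp-↭ (Perm.↭-sym T↭T′))

-- Diagonals drawn for a prefix

φ-prefix : List ℕ → List ℕ → List Seg
φ-prefix []      r = []
φ-prefix (w ∷ u) r = diagonal w (u ++ r) ∷ φ-prefix u r

φ-++ : ∀ u {y r} → φ (u ++ y ∷ r) ≡ φ-prefix u (y ∷ r) ++ φ (y ∷ r)
φ-++ []           = refl
φ-++ (w ∷ [])     = refl
φ-++ (w ∷ w′ ∷ u) = cong (diagonal w (w′ ∷ u ++ _) ∷_) (φ-++ (w′ ∷ u))

φ-prefix-resp-↭ : ∀ u {r r′} → r ↭ r′ → φ-prefix u r ≡ φ-prefix u r′
φ-prefix-resp-↭ []      _    = refl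
φ-prefix-resp-↭ (w ∷ u) r↭r′ = cong₂ _∷_ (diagonal-resp-↭ (Perm.++⁺ˡ u r↭r′)) (φ-prefix-resp-↭ u r↭r′)

φ-++-transpose : ∀ u {x z v} → φ (u ++ z ∷ x ∷ v) ≡ φ-prefix u (x ∷ z ∷ v) ++ φ (z ∷ x ∷ v)
φ-++-transpose u {x} {z} {v} =
  trans (φ-++ u) (cong (_++ φ (z ∷ x ∷ v)) (φ-prefix-resp-↭ u (Perm.swap z x Perm.refl)))

φ-head-cong : ∀ {x z} v → diagonal z v ≡ diagonal x v → φ (z ∷ v) ≡ φ (x ∷ v)
φ-head-cong []        _  = refl
φ-head-cong v@(_ ∷ _) eq = cong (_∷ φ v) eq

-- A gap (p, q) of r̂ either remains a gap of (u ++ r)̂, or the last letter of u falling into it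
-- still has p and q as neighbours when it is removed, so (p, q) is its diagonal.
adjacent-++ : ∀ u {r p q} → Adjacent (vertsOf r) p q →
  Adjacent (vertsOf (u ++ r)) p q ⊎ (p , q) ∈ₛ φ-prefix u r
adjacent-++ []      adj = inj₁ adj
adjacent-++ (w ∷ u) {r} {p} {q} adj with adjacent-++ u adj
... | inj₂ pq∈ = inj₂ (there pq∈)
... | inj₁ adj′ with p <V? fin w | fin w <V? q
...   | yes p<w | yes w<q = inj₂ (here (≡⇒SameSeg (sym (adjacent-diagonal adj′ p<w w<q))))
...   | no p≮w  | _       = inj₁ (Adjacent-resp-↭ (vertsOf-∷ w (u ++ r)) (Adjacent-∷ adj′ λ p<w _ → p≮w p<w))
...   | yes _   | no w≮q  = inj₁ (Adjacent-resp-↭ (vertsOf-∷ w (u ++ r)) (Adjacent-∷ adj′ λ _ w<q → w≮q w<q))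

adjacent⇒side : ∀ {X u r p q} R → Linked _<_ X → All (0 <_) X → (u ++ r) ↭ X →
  Adjacent (vertsOf r) p q → IsSide X (φ-prefix u r ++ R) p q
adjacent⇒side {u = u} R sorted positive perm adj with adjacent-++ u adj
... | inj₁ adj′ = inj₂ (there (adjacent⇒consecutive (vertsOf-sorted sorted positive)
                                 (Adjacent-resp-↭ (vertsOf-↭ perm) adj′)))
... | inj₂ pq∈  = inj₁ (Any.++⁺ˡ pq∈)

diagonal≁straddling : ∀ {w L x p q} → x ∈ L → w ≢ x → p <V fin x → fin x <V q →
  ¬ SameSeg (p , q) (diagonal w L)
diagonal≁straddling         x∈L w≢x p<x x<q (inj₁ (refl , refl)) = w≢x (sym (between-diagonal x∈L p<x x<q))
diagonal≁straddling {w} {L} x∈L w≢x p<x x<q (inj₂ (refl , refl)) = <V-asym (<V-trans p<x x<q) (predIn<succIn w L)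

φ-prefix∌straddling : ∀ u {r x p q} → x ∉ u → x ∈ r → p <V fin x → fin x <V q →
  ¬ (p , q) ∈ₛ φ-prefix u r
φ-prefix∌straddling (w ∷ u) x∉ x∈r p<x x<q (here pq~d) =
  diagonal≁straddling (∈-++⁺ʳ u x∈r) (λ w≡x → x∉ (here (sym w≡x))) p<x x<q pq~d
φ-prefix∌straddling (w ∷ u) x∉ x∈r p<x x<q (there pq∈) =
  φ-prefix∌straddling u (x∉ ∘ there) x∈r p<x x<q pq∈

φ-vertices : ∀ L {U V} → (U , V) ∈ₛ φ L → VertexOf L U × VertexOf L V
φ-vertices (w ∷ y ∷ r) (here (inj₁ (refl , refl))) =
  VertexOf-mono there (predIn-vertex w (y ∷ r)) , VertexOf-mono there (succIn-vertex w (y ∷ r))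
φ-vertices (w ∷ y ∷ r) (here (inj₂ (refl , refl))) =
  VertexOf-mono there (succIn-vertex w (y ∷ r)) , VertexOf-mono there (predIn-vertex w (y ∷ r))
φ-vertices (w ∷ y ∷ r) (there UV∈) =
  Product.map (VertexOf-mono there) (VertexOf-mono there) (φ-vertices (y ∷ r) UV∈)

head-side : ∀ {X} Dl {d x} v → IsSide X (Dl ++ d ∷ φ (x ∷ v)) (predIn x v) (succIn x v)
head-side Dl []      = inj₂ (here (inj₂ (refl , refl)))
head-side Dl (_ ∷ _) = inj₁ (Any.++⁺ʳ Dl (there (here (≡⇒SameSeg refl))))

-- Diagonal flips

replace-diagonal : ∀ Dl {d d′ R} → ¬ d ∈ₛ Dl → ¬ d ∈ₛ R → ∀ e →
  (e ∈ₛ (Dl ++ d′ ∷ R)) ⇔ (((e ∈ₛ (Dl ++ d ∷ R)) × ¬ SameSeg e d) ⊎ SameSeg e d′)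
replace-diagonal Dl {d} {d′} {R} d∉Dl d∉R e = mk⇔ to from
  where
  to : e ∈ₛ (Dl ++ d′ ∷ R) → ((e ∈ₛ (Dl ++ d ∷ R)) × ¬ SameSeg e d) ⊎ SameSeg e d′
  to e∈ with Any.++⁻ Dl e∈
  ... | inj₁ e∈Dl        = inj₁ (Any.++⁺ˡ e∈Dl , λ e~d → d∉Dl (∈ₛ-resp-SameSeg e~d e∈Dl))
  ... | inj₂ (here e~d′) = inj₂ e~d′
  ... | inj₂ (there e∈R) = inj₁ (Any.++⁺ʳ Dl (there e∈R) , λ e~d → d∉R (∈ₛ-resp-SameSeg e~d e∈R))
  from : ((e ∈ₛ (Dl ++ d ∷ R)) × ¬ SameSeg e d) ⊎ SameSeg e d′ → e ∈ₛ (Dl ++ d′ ∷ R)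
  from (inj₂ e~d′)        = Any.++⁺ʳ Dl (here e~d′)
  from (inj₁ (e∈ , e≁d)) with Any.++⁻ Dl e∈
  ... | inj₁ e∈Dl        = Any.++⁺ˡ e∈Dl
  ... | inj₂ (here e~d)  = contradiction e~d e≁d
  ... | inj₂ (there e∈R) = Any.++⁺ʳ Dl (there e∈R)

diagonal-flip : ∀ {X} Dl {a c p q R} → ¬ (a , c) ∈ₛ Dl → ¬ (a , c) ∈ₛ R →
  Face X (Dl ++ (a , c) ∷ R) a c p → Face X (Dl ++ (a , c) ∷ R) a c q → p ≢ q →
  DiffByFlip X (Dl ++ (a , c) ∷ R) (Dl ++ (p , q) ∷ R)
diagonal-flip Dl ac∉Dl ac∉R face-p face-q p≢q =
  _ , _ , _ , _ , ∈ₛ-middle Dl , face-p , face-q , p≢q , replace-diagonal Dl ac∉Dl ac∉R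

ordered-face : ∀ {X T a b c} → a <V b → b <V c →
  a ∈ vertsOf X → b ∈ vertsOf X → c ∈ vertsOf X →
  IsSide X T a b → IsSide X T b c → IsSide X T a c → Face X T a b c
ordered-face a<b b<c a∈ b∈ c∈ ab bc ac =
  a∈ , b∈ , c∈ , <V⇒≢ a<b , <V⇒≢ b<c , <V⇒≢ (<V-trans a<b b<c) , ab , bc , ac

Face-swap₂₃ : ∀ {X T a b c} → Face X T a b c → Face X T a c b
Face-swap₂₃ (a∈ , b∈ , c∈ , a≢b , b≢c , a≢c , ab , bc , ac) =
  a∈ , c∈ , b∈ , a≢c , b≢c ∘ sym , a≢b , ac , IsSide-sym bc , ab

quadrilateral-flip : ∀ {X u r a x z b} R → Linked _<_ X → All (0 <_) X → (u ++ r) ↭ X →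
  Adjacent (vertsOf r) a x → Adjacent (vertsOf r) x z → Adjacent (vertsOf r) z b →
  IsSide X (φ-prefix u r ++ (a , z) ∷ R) a b →
  ¬ (a , z) ∈ₛ φ-prefix u r → ¬ (a , z) ∈ₛ R →
  DiffByFlip X (φ-prefix u r ++ (a , z) ∷ R) (φ-prefix u r ++ (x , b) ∷ R)
quadrilateral-flip {X} {u} {r} {a} {x} {z} {b} R sorted positive perm ax xz zb ab az∉Dl az∉R =
  diagonal-flip (φ-prefix u r) az∉Dl az∉R face-x face-b (<V⇒≢ (<V-trans (ordered xz) (ordered zb)))
  where
  T : List Seg
  T = φ-prefix u r ++ (a , z) ∷ R
  side : ∀ {p q} → Adjacent (vertsOf r) p q → IsSide X T p q
  side = adjacent⇒side ((a , z) ∷ R) sorted positive perm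
  vertex : ∀ {p} → p ∈ vertsOf r → p ∈ vertsOf X
  vertex p∈ = VertexOf⇒∈ (VertexOf-mono (λ y∈ → Perm.∈-resp-↭ perm (∈-++⁺ʳ u y∈)) (∈⇒VertexOf p∈))
  az : IsSide X T a z
  az = inj₁ (∈ₛ-middle (φ-prefix u r))
  face-x : Face X T a z x
  face-x = Face-swap₂₃ (ordered-face (ordered ax) (ordered xz)
    (vertex (left∈ ax)) (vertex (left∈ xz)) (vertex (right∈ xz)) (side ax) (side xz) az)
  face-b : Face X T a z b
  face-b = ordered-face (<V-trans (ordered ax) (ordered xz)) (ordered zb)
    (vertex (left∈ ax)) (vertex (left∈ zb)) (vertex (right∈ zb)) az (side zb) ab

-- Transposing x and z

∉-∷ : ∀ {A : Set} {x y : A} {L} → x ≢ y → x ∉ L → x ∉ y ∷ L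
∉-∷ x≢y x∉L (here x≡y)  = x≢y x≡y
∉-∷ x≢y x∉L (there x∈L) = x∉L x∈L

transposition-distinct : ∀ {X u v x z} → Linked _<_ X → (u ++ x ∷ z ∷ v) ↭ X → x ∉ u × x ∉ v × z ∉ v
transposition-distinct {X} {u} {v} {x} {z} sorted perm =
  x∉uv ∘ ∈-++⁺ˡ , x∉uv ∘ ∈-++⁺ʳ u , z∉uv ∘ ∈-++⁺ʳ u
  where
  distinct : Unique (x ∷ z ∷ u ++ v)
  distinct = Unique-resp-↭ (Perm.↭⇒↭ₛ (Perm.↭-trans (Perm.↭-sym perm) (Perm.shifts u (x ∷ z ∷ []))))
                           (AllPairs.map <⇒≢ (Linked⇒AllPairs <-trans sorted))
  x∉uv : x ∉ u ++ v
  x∉uv = All¬⇒¬Any (All.tail (AllPairs.head distinct))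
  z∉uv : z ∉ u ++ v
  z∉uv = All¬⇒¬Any (AllPairs.head (AllPairs.tail distinct))

module _ {x y z v} (x<y : x < y) (y<z : y < z) (y∈v : y ∈ v) where

  diagonal-x∷z : diagonal x (z ∷ v) ≡ diagonal x v
  diagonal-x∷z = cong₂ _,_ (cong fin (predN-∷-≥ v (<⇒≤ (<-trans x<y y<z))))
    (succIn-unique (VertexOf-mono there (succIn-vertex x v)) (succIn-above x v) λ
      { (here refl) _   → ≤V-trans (succIn-minimal y∈v x<y) (fin≤fin (<⇒≤ y<z))
      ; (there t∈v) x<t → succIn-minimal t∈v x<t })

  diagonal-z∷x : diagonal z (x ∷ v) ≡ diagonal z v
  diagonal-z∷x = cong₂ _,_
    (cong fin (predN-unique (VertexOf-mono there (predIn-vertex z v)) (predN< v (≤-<-trans z≤n y<z)) λ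
      { (here refl) _   → <⇒≤ (<-≤-trans x<y (predN-maximal y∈v y<z))
      ; (there t∈v) t<z → predN-maximal t∈v t<z }))
    (succIn-∷-≤ v (<⇒≤ (<-trans x<y y<z)))

φ-transpose-↭ : ∀ {x y z v} → x < y → y < z → y ∈ v → φ (x ∷ z ∷ v) ↭ φ (z ∷ x ∷ v)
φ-transpose-↭ {x} {y} {z} {v@(_ ∷ _)} x<y y<z y∈v =
  subst₂ _↭_ (cong (_∷ diagonal z v ∷ φ v) (sym (diagonal-x∷z x<y y<z y∈v)))
             (cong (_∷ diagonal x v ∷ φ v) (sym (diagonal-z∷x x<y y<z y∈v)))
             (Perm.swap (diagonal x v) (diagonal z v) Perm.refl)

transposition-same : ∀ u {x y z v} → x < y → y < z → y ∈ v →
  SameTri (φ (u ++ x ∷ z ∷ v)) (φ (u ++ z ∷ x ∷ v))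
transposition-same u x<y y<z y∈v = ↭⇒SameTri
  (subst₂ _↭_ (sym (φ-++ u)) (sym (φ-++-transpose u)) (Perm.++⁺ˡ _ (φ-transpose-↭ x<y y<z y∈v)))

NoLetterBetween : ℕ → ℕ → List ℕ → Set
NoLetterBetween x z v = ∀ {y} → y ∈ v → x < y → y < z → ⊥

module _ {x z v} (x<z : x < z) (none : NoLetterBetween x z v) where

  succIn-x∷z : succIn x (z ∷ v) ≡ fin z
  succIn-x∷z = succIn-unique (letter (here refl)) (fin<fin x<z) λ
    { (here refl) _   → ≤V-refl
    ; (there y∈v) x<y → fin≤fin (≮⇒≥ (none y∈v x<y)) }

  predN-z∷x : predN z (x ∷ v) ≡ x
  predN-z∷x = predN-unique (letter (here refl)) x<z λ
    { (here refl) _   → ≤-refl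
    ; (there y∈v) y<z → ≮⇒≥ λ x<y → none y∈v x<y y<z }

  z<letter : z ∉ v → ∀ {s} → s ∈ v → x < s → z < s
  z<letter z∉v {s} s∈v x<s with <-cmp z s
  ... | tri< z<s _ _ = z<s
  ... | tri≈ _ z≡s _ = contradiction (subst (_∈ v) (sym z≡s) s∈v) z∉v
  ... | tri> _ _ s<z = ⊥-elim (none s∈v x<s s<z)

  z<succIn-x : z ∉ v → fin z <V succIn x v
  z<succIn-x z∉v with succIn x v | succIn-vertex x v | succIn-above x v
  ... | _ | origin     | x<0         = contradiction x<0 ≮V-origin
  ... | _ | letter s∈v | fin<fin x<s = fin<fin (z<letter z∉v s∈v x<s)
  ... | _ | infinity   | _           = fin<∞

  diagonal-z≡diagonal-x : x ∉ v → z ∉ v → diagonal z v ≡ diagonal x v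
  diagonal-z≡diagonal-x x∉v z∉v =
    adjacent-diagonal (gap-adjacent x∉v) (fin<fin (≤-<-trans (predN≤ x v) x<z)) (z<succIn-x z∉v)

  succIn-z∷x : x ∉ v → z ∉ v → succIn z (x ∷ v) ≡ succIn x v
  succIn-z∷x x∉v z∉v = trans (succIn-∷-≤ v (<⇒≤ x<z)) (cong proj₂ (diagonal-z≡diagonal-x x∉v z∉v))

  φ-x∷z∷v : x ∉ v → z ∉ v → φ (x ∷ z ∷ v) ≡ (predIn x v , fin z) ∷ φ (x ∷ v)
  φ-x∷z∷v x∉v z∉v = cong₂ _∷_ (cong₂ _,_ (cong fin (predN-∷-≥ v (<⇒≤ x<z))) succIn-x∷z)
                                (φ-head-cong v (diagonal-z≡diagonal-x x∉v z∉v))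

  φ-z∷x∷v : x ∉ v → z ∉ v → φ (z ∷ x ∷ v) ≡ (fin x , succIn x v) ∷ φ (x ∷ v)
  φ-z∷x∷v x∉v z∉v = cong (_∷ φ (x ∷ v)) (cong₂ _,_ (cong fin predN-z∷x) (succIn-z∷x x∉v z∉v))

  quadrilateral-adjacent : x ∉ v → z ∉ v → 0 < x →
    Adjacent (vertsOf (x ∷ z ∷ v)) (predIn x v) (fin x) ×
    Adjacent (vertsOf (x ∷ z ∷ v)) (fin x) (fin z) ×
    Adjacent (vertsOf (x ∷ z ∷ v)) (fin z) (succIn x v)
  quadrilateral-adjacent x∉v z∉v 0<x
    with insert-adjacent (∉-∷ (<⇒≢ x<z) x∉v) 0<x | insert-adjacent (∉-∷ (<⇒≢ x<z ∘ sym) z∉v) (<-trans 0<x x<z)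
  ... | ax , xz | _ , zb =
    subst (λ p → Adjacent (vertsOf (x ∷ z ∷ v)) p (fin x)) (cong fin (predN-∷-≥ v (<⇒≤ x<z))) ax ,
    subst (Adjacent (vertsOf (x ∷ z ∷ v)) (fin x)) succIn-x∷z xz ,
    Adjacent-resp-↭ (vertsOf-↭ (Perm.swap z x Perm.refl))
      (subst (Adjacent (vertsOf (z ∷ x ∷ v)) (fin z)) (succIn-z∷x x∉v z∉v) zb)

  z-not-vertex : 0 < x → z ∉ v → ¬ VertexOf (x ∷ v) (fin z)
  z-not-vertex 0<x z∉v z∈ with VertexOf-fin⁻ z∈
  ... | inj₁ z≡0   = <-irrefl (sym z≡0) (<-trans 0<x x<z)
  ... | inj₂ z∈x∷v = ∉-∷ (<⇒≢ x<z ∘ sym) z∉v z∈x∷v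

  diagonal-az-flips-to-xb : ∀ {X u} → Linked _<_ X → All (0 <_) X → (u ++ x ∷ z ∷ v) ↭ X →
    0 < x → x ∉ u → x ∉ v → z ∉ v →
    DiffByFlip X (φ-prefix u (x ∷ z ∷ v) ++ (predIn x v , fin z) ∷ φ (x ∷ v))
                 (φ-prefix u (x ∷ z ∷ v) ++ (fin x , succIn x v) ∷ φ (x ∷ v))
  diagonal-az-flips-to-xb {X} {u} sorted positive perm 0<x x∉u x∉v z∉v
    with quadrilateral-adjacent x∉v z∉v 0<x
  ... | ax , xz , zb = quadrilateral-flip (φ (x ∷ v)) sorted positive perm ax xz zb
    (head-side (φ-prefix u (x ∷ z ∷ v)) v)
    (φ-prefix∌straddling u x∉u (here refl) (ordered ax) (ordered xz))
    (λ az∈ → z-not-vertex 0<x z∉v (proj₂ (φ-vertices (x ∷ v) az∈)))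

transposition-flip : ∀ {X u v x z} → Linked _<_ X → All (0 <_) X → (u ++ x ∷ z ∷ v) ↭ X →
  x < z → NoLetterBetween x z v → DiffByFlip X (φ (u ++ x ∷ z ∷ v)) (φ (u ++ z ∷ x ∷ v))
transposition-flip {X} {u} {v} {x} {z} sorted positive perm x<z none with transposition-distinct sorted perm
... | x∉u , x∉v , z∉v = subst₂ (DiffByFlip X)
  (sym (trans (φ-++ u) (cong (φ-prefix u (x ∷ z ∷ v) ++_) (φ-x∷z∷v x<z none x∉v z∉v))))
  (sym (trans (φ-++-transpose u) (cong (φ-prefix u (x ∷ z ∷ v) ++_) (φ-z∷x∷v x<z none x∉v z∉v))))
  (diagonal-az-flips-to-xb x<z none sorted positive perm 0<x x∉u x∉v z∉v)
  where
  0<x : 0 < x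
  0<x = All.lookup positive (Perm.∈-resp-↭ perm (∈-++⁺ʳ u (here refl)))

mainTheorem3 : (X : List ℕ) → Linked _<_ X → All (0 <_) X →
    (u v : List ℕ) (x z : ℕ) → x < z → (u ++ x ∷ z ∷ v) ↭ X →
    ((¬ (∃ λ y → (y ∈ v) × (x < y) × (y < z))) →
        DiffByFlip X (φ (u ++ x ∷ z ∷ v)) (φ (u ++ z ∷ x ∷ v)))
    × ((∃ λ y → (y ∈ v) × (x < y) × (y < z)) →
        SameTri (φ (u ++ x ∷ z ∷ v)) (φ (u ++ z ∷ x ∷ v)))
mainTheorem3 X sorted positive u v x z x<z perm =
  (λ none → transposition-flip sorted positive perm x<z (λ y∈v x<y y<z → none (_ , y∈v , x<y , y<z))) ,
  (λ { (_ , y∈v , x<y , y<z) → transposition-same u x<y y<z y∈v })
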